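{- Let $k\ge 4$ and let $G_k=(X_k,\mathscr{M}_k)$ be the $k$-graph with $X_k=\{v_1,\dots,v_{2k-1}\}$ and $\mathscr{M}_k=\{M_i=\{v_i,v_{i+1},\dots,v_{i+k-1}\}: i\in\{1,\dots,k\}\}$. Let $\widetilde{G}_k=(\widetilde{X}_k,\widetilde{\mathscr{M}}_k)$ be obtained by adding, for each $i\in\{1,\dots,k\}$, two new vertices $a_i,b_i$ (all pairwise distinct and not in $X_k$), so that $\widetilde{X}_k=X_k\cup\bigcup_{i=1}^k\{a_i,b_i\}$ and $\widetilde{\mathscr{M}}_k=\{M_i\cup\{a_i,b_i\}: 1\le i\le k\}$. If $\phi$ is an automorphism of $\widetilde{G}_k$ with $\phi(\{v_1,v_{2k-2},v_{2k-1}\})=\{v_1,v_{2k-2},v_{2k-1}\}$, then $\phi(v)=v$ for every $v\in X_k$.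
   Context: An automorphism of a hypergraph $(X,\mathscr{M})$ is a bijection $\phi:X\to X$ with $\{\phi(M):M\in\mathscr{M}\}=\mathscr{M}$. -}

module Defs where

open import Data.Nat using (ℕ; _+_; _*_; _∸_; _≤_; _<_)
open import Data.Fin using (Fin; toℕ)
open import Data.Product using (Σ; ∃; _×_)
open import Data.Sum using (_⊎_)
open import Relation.Binary.PropositionalEquality using (_≡_)
open import Function.Bundles using (_⤖_; _⇔_; Bijection)

-- Vertices of G̃_k (0-indexed):
--   vv j  (j : Fin (2k-1))  is  v_{j+1}
--   aa i, bb i (i : Fin k)  are a_{i+1}, b_{i+1}
data V (k : ℕ) : Set where
  vv : Fin (2 * k ∸ 1) → V k
  aa : Fin k → V k
  bb : Fin k → V k

-- Membership in the hyperedge  M̃_{i+1} = {v_{i+1},…,v_{i+k}} ∪ {a_{i+1}, b_{i+1}}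
Edge : (k : ℕ) → Fin k → V k → Set
Edge k i (vv j) = toℕ i ≤ toℕ j × toℕ j < toℕ i + k
Edge k i (aa i') = i' ≡ i
Edge k i (bb i') = i' ≡ i

Image : ∀ {k} → (V k → V k) → (V k → Set) → V k → Set
Image f A x = Σ _ λ y → A y × f y ≡ x

_≐_ : ∀ {k} → (V k → Set) → (V k → Set) → Set
A ≐ B = ∀ x → A x ⇔ B x

-- φ is an automorphism of G̃_k: a bijection with {φ(M) : M ∈ 𝓜̃} = 𝓜̃
IsAutomorphism : (k : ℕ) → (V k ⤖ V k) → Set
IsAutomorphism k φ =
  (∀ i → ∃ λ j → Image (Bijection.to φ) (Edge k i) ≐ Edge k j) ×
  (∀ j → ∃ λ i → Image (Bijection.to φ) (Edge k i) ≐ Edge k j)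

Ends : (k : ℕ) → V k → Set
Ends k x = Σ (Fin (2 * k ∸ 1)) λ j → x ≡ vv j ×
  (toℕ j ≡ 0 ⊎ toℕ j ≡ 2 * k ∸ 3 ⊎ toℕ j ≡ 2 * k ∸ 2)

module Submission where

-- An automorphism φ permutes the hyperedges, M̃ᵢ ↦ M̃_{σ i}. The vertex v_{2k-2} lies in two
-- hyperedges while v₁ and v_{2k-1} lie in only one, so φ fixes v_{2k-2}; hence φ(v_{2k-1}) is
-- v_{2k-1} (v₁ is impossible: M̃₁ ∌ v_{2k-2} once k ≥ 3), and σ fixes the last hyperedge. On
-- intervals, Mᵢ ∩ Mⱼ ⊆ Mₗ says exactly that l lies between i and j; σ preserves this relation and
-- fixes the last index, so it is monotone, hence the identity. Then every v ∈ X_k lies in the same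
-- hyperedges as φ(v); φ(v) ∈ X_k (ends go to ends, other vertices lie in two hyperedges, which no
-- aᵢ or bᵢ does), and distinct vertices of X_k lie in distinct sets of hyperedges.

open import Defs
open import Data.Nat using (ℕ; suc; _+_; _*_; _∸_; _≤_; _<_; z≤n; s≤s; s≤s⁻¹)
open import Data.Nat.Properties
open import Data.Nat.Tactic.RingSolver using (solve-∀)
open import Data.Fin.Base as Fin using (Fin; toℕ; fromℕ; fromℕ<; inject₁)
open import Data.Fin.Properties
  using (toℕ-injective; toℕ-fromℕ; toℕ-fromℕ<; toℕ-inject₁; toℕ<n; toℕ≤pred[n]; ≤fromℕ; ≤̄⇒inject₁<)
open import Data.Fin.Induction using (<-weakInduction; >-weakInduction)
open import Data.Product using (∃; ∃₂; _×_; _,_; proj₁; proj₂)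
open import Data.Sum using (_⊎_; inj₁; inj₂)
open import Data.Empty using (⊥-elim)
open import Function using (_∘_)
open import Function.Bundles using (_⤖_; Bijection; _⇔_; mk⇔; Equivalence)
import Function.Properties.Equivalence as ⇔
open import Relation.Binary using (_Preserves_⟶_; tri<; tri≈; tri>)
open import Relation.Binary.PropositionalEquality
  using (_≡_; _≢_; refl; sym; trans; cong; subst; subst₂; module ≡-Reasoning)
open import Relation.Nullary using (¬_; yes; no)

module _ {n : ℕ} {f : Fin (suc n) → Fin (suc n)} (f-mono : f Preserves Fin._<_ ⟶ Fin._<_) where

  strictMono⇒inflationary : ∀ i → i Fin.≤ f i
  strictMono⇒inflationary = <-weakInduction (λ i → i Fin.≤ f i) z≤n step
    where
    step : ∀ i → inject₁ i Fin.≤ f (inject₁ i) → Fin.suc i Fin.≤ f (Fin.suc i)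
    step i ih = ≤-trans (s≤s (subst (_≤ toℕ (f (inject₁ i))) (toℕ-inject₁ i) ih))
                        (f-mono (≤̄⇒inject₁< {i = i} {j = i} ≤-refl))

  strictMono⇒deflationary : ∀ i → f i Fin.≤ i
  strictMono⇒deflationary = >-weakInduction (λ i → f i Fin.≤ i) (≤fromℕ _) step
    where
    step : ∀ i → f (Fin.suc i) Fin.≤ Fin.suc i → f (inject₁ i) Fin.≤ inject₁ i
    step i ih = subst (toℕ (f (inject₁ i)) ≤_) (sym (toℕ-inject₁ i))
                  (s≤s⁻¹ (≤-trans (f-mono (≤̄⇒inject₁< {i = i} {j = i} ≤-refl)) ih))

  strictMono⇒≗id : ∀ i → f i ≡ i
  strictMono⇒≗id i =
    toℕ-injective (≤-antisym (strictMono⇒deflationary i) (strictMono⇒inflationary i))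

vv-injective : ∀ {k} {j j′ : Fin (2 * k ∸ 1)} → vv {k} j ≡ vv j′ → j ≡ j′
vv-injective refl = refl

Shared : (k : ℕ) → V k → Set
Shared k x = ∃₂ λ i l → i ≢ l × Edge k i x × Edge k l x

Between : (k : ℕ) → Fin k → Fin k → Fin k → Set
Between k i j l = ∀ x → Edge k i x → Edge k j x → Edge k l x

SameEdges : (k : ℕ) → V k → V k → Set
SameEdges k x y = ∀ i → Edge k i x ⇔ Edge k i y

Shared⇒vv : ∀ {k x} → Shared k x → ∃ λ j → x ≡ vv j
Shared⇒vv {x = vv j} _ = j , refl
Shared⇒vv {x = aa _} (_ , _ , i≢l , refl , refl) = ⊥-elim (i≢l refl)
Shared⇒vv {x = bb _} (_ , _ , i≢l , refl , refl) = ⊥-elim (i≢l refl)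

Ends⇒vv : ∀ {k x} → Ends k x → ∃ λ j → x ≡ vv j
Ends⇒vv (j , x≡j , _) = j , x≡j

module Automorphism {k : ℕ} (φ : V k ⤖ V k) (φ-aut : IsAutomorphism k φ) where

  f : V k → V k
  f = Bijection.to φ

  -- σ i indexes φ(M̃ᵢ).
  σ : Fin k → Fin k
  σ i = proj₁ (proj₁ φ-aut i)

  Edge-σ : ∀ {i x} → Edge k i x → Edge k (σ i) (f x)
  Edge-σ {i} {x} e = Equivalence.to (proj₂ (proj₁ φ-aut i) (f x)) (x , e , refl)

  Edge-σ⁻ : ∀ {i x} → Edge k (σ i) (f x) → Edge k i x
  Edge-σ⁻ {i} {x} e with Equivalence.from (proj₂ (proj₁ φ-aut i) (f x)) e
  ... | y , e′ , fy≡fx = subst (Edge k i) (Bijection.injective φ fy≡fx) e′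

  σ-injective : ∀ {i l} → σ i ≡ σ l → i ≡ l
  σ-injective {i} σi≡σl = Edge-σ⁻ (subst (λ s → Edge k s (f (aa i))) σi≡σl (Edge-σ refl))

  Shared-f : ∀ {x} → Shared k x → Shared k (f x)
  Shared-f (i , l , i≢l , ei , el) = σ i , σ l , i≢l ∘ σ-injective , Edge-σ ei , Edge-σ el

  Between-σ : ∀ {i j l} → Between k i j l → Between k (σ i) (σ j) (σ l)
  Between-σ b y ei ej with Bijection.strictlySurjective φ y
  ... | x , refl = Edge-σ (b x (Edge-σ⁻ ei) (Edge-σ⁻ ej))

  σ≗id⇒SameEdges : (∀ i → σ i ≡ i) → ∀ x → SameEdges k x (f x)
  σ≗id⇒SameEdges σ≗id x i = mk⇔
    (λ e → subst (λ s → Edge k s (f x)) (σ≗id i) (Edge-σ e))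
    (λ e → Edge-σ⁻ (subst (λ s → Edge k s (f x)) (sym (σ≗id i)) e))

2[1+m]≡2+m+m : ∀ m → 2 * suc m ≡ suc (suc (m + m))
2[1+m]≡2+m+m = solve-∀

-- Here k = m + 1, vertex vⱼ₊₁ has index j ∈ [0, 2m], and M̃ᵢ₊₁ ∩ X_k is the interval [i, i + m].
module Interval (m : ℕ) where

  Vertex : Set
  Vertex = Fin (2 * suc m ∸ 1)

  index≤ : (j : Vertex) → toℕ j ≤ m + m
  index≤ j = s≤s⁻¹ (subst (toℕ j <_) (cong (_∸ 1) (2[1+m]≡2+m+m m)) (toℕ<n j))

  vertex : ∀ n → .(n ≤ m + m) → Vertex
  vertex n n≤2m = fromℕ< (subst (n <_) (sym (cong (_∸ 1) (2[1+m]≡2+m+m m))) (s≤s n≤2m))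

  toℕ-vertex : ∀ {n} .(n≤2m : n ≤ m + m) → toℕ (vertex n n≤2m) ≡ n
  toℕ-vertex {n} n≤2m = toℕ-fromℕ< (subst (n <_) (sym (cong (_∸ 1) (2[1+m]≡2+m+m m))) (s≤s n≤2m))

  edge : ∀ n → .(n ≤ m) → Fin (suc m)
  edge n n≤m = fromℕ< (s≤s n≤m)

  toℕ-edge : ∀ {n} .(n≤m : n ≤ m) → toℕ (edge n n≤m) ≡ n
  toℕ-edge n≤m = toℕ-fromℕ< (s≤s n≤m)

  ∈edge : ∀ {i j a b} → toℕ i ≡ a → toℕ j ≡ b → a ≤ b → b ≤ a + m → Edge (suc m) i (vv j)
  ∈edge {a = a} {b} refl refl a≤b b≤a+m = a≤b , subst (suc b ≤_) (sym (+-suc a m)) (s≤s b≤a+m)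

  edge-upper : ∀ {i j} → Edge (suc m) i (vv j) → toℕ j ≤ toℕ i + m
  edge-upper {i} {j} (_ , j<i+k) = s≤s⁻¹ (subst (suc (toℕ j) ≤_) (+-suc (toℕ i) m) j<i+k)

  between⇒ordered : ∀ {i j l} → Between (suc m) i j l → i Fin.≤ j → i Fin.≤ l × l Fin.≤ j
  between⇒ordered {i} {j} {l} b i≤j = i≤l , l≤j
    where
    j≤i+m : toℕ j ≤ toℕ i + m
    j≤i+m = ≤-trans (toℕ≤pred[n] j) (m≤n+m m (toℕ i))
    j≤2m : toℕ j ≤ m + m
    j≤2m = ≤-trans (toℕ≤pred[n] j) (m≤m+n m m)
    i+m≤2m : toℕ i + m ≤ m + m
    i+m≤2m = +-monoˡ-≤ m (toℕ≤pred[n] i)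
    l≤j : l Fin.≤ j
    l≤j = subst (toℕ l ≤_) (toℕ-vertex j≤2m) (proj₁ (b (vv (vertex (toℕ j) j≤2m))
            (∈edge refl (toℕ-vertex j≤2m) i≤j j≤i+m)
            (∈edge refl (toℕ-vertex j≤2m) ≤-refl (m≤m+n (toℕ j) m))))
    i≤l : i Fin.≤ l
    i≤l = +-cancelʳ-≤ m (toℕ i) (toℕ l) (subst (_≤ toℕ l + m) (toℕ-vertex i+m≤2m) (edge-upper
            (b (vv (vertex (toℕ i + m) i+m≤2m))
               (∈edge refl (toℕ-vertex i+m≤2m) (m≤m+n (toℕ i) m) ≤-refl)
               (∈edge refl (toℕ-vertex i+m≤2m) j≤i+m (+-monoˡ-≤ m i≤j)))))

  ordered⇒between : ∀ {i j l} → i Fin.≤ l → l Fin.≤ j → Between (suc m) i j l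
  ordered⇒between i≤l l≤j (vv x) (_ , x<i+k) (j≤x , _) =
    ≤-trans l≤j j≤x , <-≤-trans x<i+k (+-monoˡ-≤ (suc m) i≤l)
  ordered⇒between i≤l l≤j (aa _) refl refl = toℕ-injective (≤-antisym i≤l l≤j)
  ordered⇒between i≤l l≤j (bb _) refl refl = toℕ-injective (≤-antisym i≤l l≤j)

  Edge-first : ∀ {i j} → Edge (suc m) i (vv j) → toℕ j ≡ 0 → toℕ i ≡ 0
  Edge-first (i≤j , _) j≡0 = n≤0⇒n≡0 (subst (_ ≤_) j≡0 i≤j)

  ¬Shared-first : ∀ {j} → toℕ j ≡ 0 → ¬ Shared (suc m) (vv j)
  ¬Shared-first j≡0 (i , l , i≢l , ei , el) =
    i≢l (toℕ-injective (trans (Edge-first ei j≡0) (sym (Edge-first el j≡0))))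

  Edge-last : ∀ {i j} → Edge (suc m) i (vv j) → toℕ j ≡ m + m → i ≡ fromℕ m
  Edge-last {i} e j≡2m = toℕ-injective (trans (≤-antisym (toℕ≤pred[n] i) m≤i) (sym (toℕ-fromℕ m)))
    where
    m≤i : m ≤ toℕ i
    m≤i = +-cancelʳ-≤ m m (toℕ i) (subst (_≤ toℕ i + m) j≡2m (edge-upper e))

  ¬Shared-last : ∀ {j} → toℕ j ≡ m + m → ¬ Shared (suc m) (vv j)
  ¬Shared-last j≡2m (i , l , i≢l , ei , el) =
    i≢l (trans (Edge-last ei j≡2m) (sym (Edge-last el j≡2m)))

  index∸m≤m : (j : Vertex) → toℕ j ∸ m ≤ m
  index∸m≤m j = m≤n+o⇒m∸n≤o (toℕ j) m (subst (toℕ j ≤_) (+-comm m m) (index≤ j))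

  -- Truncated subtraction makes this 0 when j < m: it is the lowest edge through vⱼ in all cases.
  lowestEdge : Vertex → Fin (suc m)
  lowestEdge j = edge (toℕ j ∸ m) (index∸m≤m j)

  toℕ-lowestEdge : ∀ j → toℕ (lowestEdge j) ≡ toℕ j ∸ m
  toℕ-lowestEdge j = toℕ-edge (index∸m≤m j)

  lowestEdge-∋ : ∀ j → Edge (suc m) (lowestEdge j) (vv j)
  lowestEdge-∋ j = ∈edge (toℕ-lowestEdge j) refl (m∸n≤m (toℕ j) m)
                     (subst (toℕ j ≤_) (+-comm m (toℕ j ∸ m)) (m≤n+m∸n (toℕ j) m))

  interior⇒Shared : ∀ {j} → 0 < toℕ j → toℕ j < m + m → Shared (suc m) (vv j)
  interior⇒Shared {j} 0<j j<2m with toℕ j ≤? m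
  ... | yes j≤m = Fin.zero , edge (toℕ j) j≤m , 0≢j , (z≤n , s≤s j≤m) ,
                  ∈edge (toℕ-edge j≤m) refl ≤-refl (m≤m+n (toℕ j) m)
    where
    0≢j : Fin.zero ≢ edge (toℕ j) j≤m
    0≢j 0≡j = <⇒≢ 0<j (trans (cong toℕ 0≡j) (toℕ-edge j≤m))
  ... | no j≰m = lowestEdge j , fromℕ m , lowest≢m , lowestEdge-∋ j ,
                  ∈edge (toℕ-fromℕ m) refl (<⇒≤ (≰⇒> j≰m)) (index≤ j)
    where
    lowest≢m : lowestEdge j ≢ fromℕ m
    lowest≢m eq = <⇒≢ j<2m (begin
      toℕ j                    ≡⟨ sym (m∸n+n≡m (<⇒≤ (≰⇒> j≰m))) ⟩
      toℕ j ∸ m + m            ≡⟨ cong (_+ m) (sym (toℕ-lowestEdge j)) ⟩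
      toℕ (lowestEdge j) + m   ≡⟨ cong (λ i → toℕ i + m) eq ⟩
      toℕ (fromℕ m) + m        ≡⟨ cong (_+ m) (toℕ-fromℕ m) ⟩
      m + m                    ∎)
      where open ≡-Reasoning

  end-or-Shared : ∀ j → toℕ j ≡ 0 ⊎ toℕ j ≡ m + m ⊎ Shared (suc m) (vv j)
  end-or-Shared j with toℕ j ≟ 0 | toℕ j ≟ m + m
  ... | yes j≡0 | _       = inj₁ j≡0
  ... | no _    | yes j≡2m = inj₂ (inj₁ j≡2m)
  ... | no j≢0  | no j≢2m  = inj₂ (inj₂ (interior⇒Shared (n≢0⇒n>0 j≢0) (≤∧≢⇒< (index≤ j) j≢2m)))

  Separates : Fin (suc m) → Vertex → Vertex → Set
  Separates i j j′ = Edge (suc m) i (vv j) × ¬ Edge (suc m) i (vv j′)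

  separating-edge : ∀ {j j′} → j Fin.< j′ → ∃ λ i → Separates i j j′ ⊎ Separates i j′ j
  separating-edge {j} {j′} j<j′ with toℕ j′ ≤? m | m ≤? toℕ j
  ... | yes j′≤m | _ = edge (toℕ j′) j′≤m , inj₂
        (∈edge (toℕ-edge j′≤m) refl ≤-refl (m≤m+n (toℕ j′) m) ,
         λ e → <⇒≱ j<j′ (subst (_≤ toℕ j) (toℕ-edge j′≤m) (proj₁ e)))
  ... | no _ | yes m≤j = lowestEdge j , inj₁ (lowestEdge-∋ j ,
         λ e → <⇒≱ j<j′ (subst (toℕ j′ ≤_) (trans (cong (_+ m) (toℕ-lowestEdge j)) (m∸n+n≡m m≤j))
                            (edge-upper e)))
  ... | no j′≰m | no m≰j = fromℕ m , inj₂
        (∈edge (toℕ-fromℕ m) refl (<⇒≤ (≰⇒> j′≰m)) (index≤ j′) ,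
         λ e → m≰j (subst (_≤ toℕ j) (toℕ-fromℕ m) (proj₁ e)))

  SameEdges⇒¬separated : ∀ {j j′} → SameEdges (suc m) (vv j) (vv j′) →
                         ¬ (∃ λ i → Separates i j j′ ⊎ Separates i j′ j)
  SameEdges⇒¬separated same (i , inj₁ (e , ¬e′)) = ¬e′ (Equivalence.to (same i) e)
  SameEdges⇒¬separated same (i , inj₂ (e′ , ¬e)) = ¬e (Equivalence.from (same i) e′)

  SameEdges-vv⇒≡ : ∀ {j j′} → SameEdges (suc m) (vv j) (vv j′) → j ≡ j′
  SameEdges-vv⇒≡ {j} {j′} same with <-cmp (toℕ j) (toℕ j′)
  ... | tri≈ _ j≡j′ _ = toℕ-injective j≡j′
  ... | tri< j<j′ _ _ = ⊥-elim (SameEdges⇒¬separated same (separating-edge j<j′))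
  ... | tri> _ _ j′<j = ⊥-elim (SameEdges⇒¬separated (⇔.sym ∘ same) (separating-edge j′<j))

module Lemma14 (p : ℕ) (φ : V (3 + p) ⤖ V (3 + p)) (φ-aut : IsAutomorphism (3 + p) φ)
               (φ-ends : Image (Bijection.to φ) (Ends (3 + p)) ≐ Ends (3 + p)) where

  m : ℕ
  m = 2 + p

  open Automorphism φ φ-aut
  open Interval m

  2k∸2≡2m : 2 * (3 + p) ∸ 2 ≡ m + m
  2k∸2≡2m = cong (_∸ 2) (2[1+m]≡2+m+m m)

  2k∸3≡2m∸1 : 2 * (3 + p) ∸ 3 ≡ m + m ∸ 1
  2k∸3≡2m∸1 = cong (_∸ 3) (2[1+m]≡2+m+m m)

  Ends-f : ∀ {x} → Ends (3 + p) x → Ends (3 + p) (f x)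
  Ends-f {x} e = Equivalence.to (φ-ends (f x)) (x , e , refl)

  last penult : Vertex
  last = vertex (m + m) ≤-refl
  penult = vertex (m + m ∸ 1) (n≤1+n _)

  toℕ-last : toℕ last ≡ m + m
  toℕ-last = toℕ-vertex ≤-refl

  toℕ-penult : toℕ penult ≡ m + m ∸ 1
  toℕ-penult = toℕ-vertex (n≤1+n _)

  ≡penult : ∀ {j} → toℕ j ≡ 2 * (3 + p) ∸ 3 → j ≡ penult
  ≡penult j≡ = toℕ-injective (trans (trans j≡ 2k∸3≡2m∸1) (sym toℕ-penult))

  lastEdge : Fin (3 + p)
  lastEdge = fromℕ m

  last∈lastEdge : Edge (3 + p) lastEdge (vv last)
  last∈lastEdge = ∈edge (toℕ-fromℕ m) toℕ-last (m≤n+m m m) ≤-refl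

  penult∈lastEdge : Edge (3 + p) lastEdge (vv penult)
  penult∈lastEdge = ∈edge (toℕ-fromℕ m) toℕ-penult (m≤n+m m (suc p)) (n≤1+n _)

  penult-Shared : Shared (3 + p) (vv penult)
  penult-Shared = interior⇒Shared (subst (0 <_) (sym toℕ-penult) (s≤s z≤n))
                                  (subst (_< m + m) (sym toℕ-penult) ≤-refl)

  f-penult : f (vv penult) ≡ vv penult
  f-penult with Ends-f (penult , refl , inj₂ (inj₁ (trans toℕ-penult (sym 2k∸3≡2m∸1))))
  ... | j , fx≡j , inj₁ j≡0 =
    ⊥-elim (¬Shared-first j≡0 (subst (Shared _) fx≡j (Shared-f penult-Shared)))
  ... | j , fx≡j , inj₂ (inj₂ j≡) =
    ⊥-elim (¬Shared-last (trans j≡ 2k∸2≡2m) (subst (Shared _) fx≡j (Shared-f penult-Shared)))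
  ... | j , fx≡j , inj₂ (inj₁ j≡) = trans fx≡j (cong vv (≡penult j≡))

  σ-lastEdge : σ lastEdge ≡ lastEdge
  σ-lastEdge with Ends-f (last , refl , inj₂ (inj₂ (trans toℕ-last (sym 2k∸2≡2m))))
  ... | j , fx≡j , inj₁ j≡0 = ⊥-elim (<⇒≱ (+-monoˡ-≤ m (s≤s z≤n)) penult≤m)
    where
    σlastEdge≡0 : toℕ (σ lastEdge) ≡ 0
    σlastEdge≡0 = Edge-first (subst (Edge _ (σ lastEdge)) fx≡j (Edge-σ last∈lastEdge)) j≡0
    penult≤m : m + m ∸ 1 ≤ m
    penult≤m = subst₂ _≤_ toℕ-penult (cong (_+ m) σlastEdge≡0)
                 (edge-upper (subst (Edge _ (σ lastEdge)) f-penult (Edge-σ penult∈lastEdge)))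
  ... | j , fx≡j , inj₂ (inj₁ j≡) = ⊥-elim (1+n≢n (begin
    m + m       ≡⟨ sym toℕ-last ⟩
    toℕ last    ≡⟨ cong toℕ (vv-injective (Bijection.injective φ f-last≡f-penult)) ⟩
    toℕ penult  ≡⟨ toℕ-penult ⟩
    m + m ∸ 1   ∎))
    where
    open ≡-Reasoning
    f-last≡f-penult : f (vv last) ≡ f (vv penult)
    f-last≡f-penult = trans fx≡j (trans (cong vv (≡penult j≡)) (sym f-penult))
  ... | j , fx≡j , inj₂ (inj₂ j≡) =
    Edge-last (subst (Edge _ (σ lastEdge)) fx≡j (Edge-σ last∈lastEdge)) (trans j≡ 2k∸2≡2m)

  σ-monotone : σ Preserves Fin._<_ ⟶ Fin._<_
  σ-monotone {i} {l} i<l =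
    ≤∧≢⇒< σi≤σl (λ eq → <⇒≢ i<l (cong toℕ (σ-injective (toℕ-injective eq))))
    where
    between : Between (3 + p) (σ i) lastEdge (σ l)
    between = subst (λ e → Between _ (σ i) e (σ l)) σ-lastEdge
                (Between-σ (ordered⇒between (<⇒≤ i<l) (≤fromℕ l)))
    σi≤σl : σ i Fin.≤ σ l
    σi≤σl = proj₁ (between⇒ordered between (≤fromℕ (σ i)))

  f-vv : ∀ j → ∃ λ j′ → f (vv j) ≡ vv j′
  f-vv j with end-or-Shared j
  ... | inj₁ j≡0 = Ends⇒vv (Ends-f (j , refl , inj₁ j≡0))
  ... | inj₂ (inj₁ j≡2m) = Ends⇒vv (Ends-f (j , refl , inj₂ (inj₂ (trans j≡2m (sym 2k∸2≡2m)))))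
  ... | inj₂ (inj₂ shared) = Shared⇒vv (Shared-f shared)

  f-fixes-vv : ∀ j → f (vv j) ≡ vv j
  f-fixes-vv j with f-vv j
  ... | j′ , fx≡j′ = trans fx≡j′ (cong vv (sym (SameEdges-vv⇒≡
          (subst (SameEdges _ (vv j)) fx≡j′ (σ≗id⇒SameEdges (strictMono⇒≗id σ-monotone) (vv j))))))

lemma14 : (k : ℕ) → 4 ≤ k → (φ : V k ⤖ V k) → IsAutomorphism k φ →
    Image (Bijection.to φ) (Ends k) ≐ Ends k →
    (j : Fin (2 * k ∸ 1)) → Bijection.to φ (vv j) ≡ vv j
lemma14 (suc (suc (suc p))) (s≤s (s≤s (s≤s _))) φ φ-aut φ-ends =
  Lemma14.f-fixes-vv p φ φ-aut φ-ends
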